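{- Let $n\ge1$, $(\alpha_1,\dots,\alpha_n)\in(\mathbb{N}^*)^n$ and $(\beta_1,\dots,\beta_n)\in(\mathbb{N}^*)^n$ with $\beta_i\ne\beta_j$ for $i\ne j$. Put $\theta=\alpha_1+\dots+\alpha_n$ and $\gamma=(\gamma_1,\dots,\gamma_\theta)=(\beta_1,\dots,\beta_1,\dots,\beta_n,\dots,\beta_n)$ ($\beta_j$ repeated $\alpha_j$ times). For $\sigma\in\mathfrak{S}_\theta$ let $w_{\gamma,\sigma}=W_{(\gamma_{\sigma(1)},\dots,\gamma_{\sigma(\theta)})}$. Then the element $$P_{\Lambda_\gamma}=\frac{1}{\alpha_1!\cdots\alpha_n!}\sum_{\sigma\in\mathfrak{S}_\theta}\sum_{i=1}^{\alpha_1}(-1)^{\sigma^{ -1}(i)-1}\binom{\theta-1}{\sigma^{ -1}(i)-1}w_{\gamma,\sigma}$$ is primitive in $\mathbf{ISPW}$.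
   Context: $\mathbb{K}$ is a field of characteristic $0$. For a composition $\alpha=(\alpha_1,\dots,\alpha_k)$ of positive integers, $W_\alpha$ denotes the word $x_1^{\alpha_1}\cdots x_k^{\alpha_k}$ ($\alpha_1$ letters $x_1$, then $\alpha_2$ letters $x_2$, …). $\mathbf{ISPW}$ is the vector space with basis $(W_\alpha)$ (including $W_{()}=1$), product $W_\alpha\ast W_\beta=W_{\alpha\beta}$ (concatenation of compositions) and coproduct $\Delta(W_{(\alpha_1,\dots,\alpha_k)})=\sum_{I\sqcup U=\{1,\dots,k\}}W_{(\alpha_{i_1},\dots,\alpha_{i_p})}\otimes W_{(\alpha_{u_1},\dots,\alpha_{u_s})}$ with $I=\{i_1<\dots<i_p\}$, $U=\{u_1<\dots<u_s\}$. An element $p$ is primitive if $\Delta(p)=p\otimes1+1\otimes p$. -}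

module Defs where

open import Level using (Level; _⊔_) renaming (suc to lsuc)
open import Algebra.Bundles using (CommutativeRing)
open import Data.Nat as ℕ using (ℕ; zero; suc; _∸_; _<ᵇ_)
open import Data.Nat.Combinatorics using (_C_)
open import Data.Nat using (_!)
open import Data.Fin using (Fin; toℕ)
open import Data.Fin.Permutation using (Permutation′; id; insert; _⟨$⟩ʳ_; _⟨$⟩ˡ_)
open import Data.List as List using (List; []; _∷_; concatMap; map; foldr; allFin)
open import Data.List.Properties using (≡-dec)
open import Data.Vec as Vec using (Vec; []; _∷_; _++_; replicate; lookup)
open import Data.Product using (_×_; _,_)
open import Data.Bool using (if_then_else_)
open import Relation.Nullary using (¬_; does)
open import Relation.Binary.PropositionalEquality using (_≡_)

record Field (c ℓ : Level) : Set (lsuc (c ⊔ ℓ)) where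
  field
    commutativeRing : CommutativeRing c ℓ
  open CommutativeRing commutativeRing public
  field
    _⁻¹      : Carrier → Carrier
    0≉1      : ¬ (0# ≈ 1#)
    inverseʳ : ∀ x → ¬ (x ≈ 0#) → (x * (x ⁻¹)) ≈ 1#

module _ {c ℓ : Level} (K : Field c ℓ) where
  open Field K

  ℕ→K : ℕ → Carrier
  ℕ→K zero    = 0#
  ℕ→K (suc n) = 1# + ℕ→K n

  CharZero : Set ℓ
  CharZero = ∀ n → ¬ (ℕ→K (suc n) ≈ 0#)

  neg1^ : ℕ → Carrier
  neg1^ zero    = 1#
  neg1^ (suc k) = (- 1#) * neg1^ k

  -- ISPW: elements are finite formal K-linear combinations of the
  -- basis words W_α, α a list of letters (composition).  An element is a
  -- list of (coefficient, α); equality is equality of all coefficients.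
  Word : Set
  Word = List ℕ

  ISPW : Set c
  ISPW = List (Carrier × Word)

  ISPW⊗ISPW : Set c
  ISPW⊗ISPW = List (Carrier × Word × Word)

  coeff : ISPW → Word → Carrier
  coeff []             w = 0#
  coeff ((a , u) ∷ xs) w =
    (if does (≡-dec ℕ._≟_ u w) then a else 0#) + coeff xs w

  coeff₂ : ISPW⊗ISPW → Word → Word → Carrier
  coeff₂ []                 w w′ = 0#
  coeff₂ ((a , u , v) ∷ xs) w w′ =
    (if does (≡-dec ℕ._≟_ u w) then
       (if does (≡-dec ℕ._≟_ v w′) then a else 0#) else 0#) + coeff₂ xs w w′

  splits : Word → List (Word × Word)
  splits []      = ([] , []) ∷ []
  splits (a ∷ w) = concatMap (λ { (u , v) → (a ∷ u , v) ∷ (u , a ∷ v) ∷ [] }) (splits w)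

  Δ : ISPW → ISPW⊗ISPW
  Δ = concatMap (λ { (a , w) → map (λ { (u , v) → (a , u , v) }) (splits w) })

  p⊗1+1⊗p : ISPW → ISPW⊗ISPW
  p⊗1+1⊗p p = map (λ { (a , w) → (a , w , []) }) p List.++ map (λ { (a , w) → (a , [] , w) }) p

  Primitive : ISPW → Set ℓ
  Primitive p = ∀ u v → coeff₂ (Δ p) u v ≈ coeff₂ (p⊗1+1⊗p p) u v

  allPerms : (n : ℕ) → List (Permutation′ n)
  allPerms zero    = id ∷ []
  allPerms (suc n) = concatMap (λ π → map (λ j → insert Fin.zero j π) (allFin (suc n))) (allPerms n)

  gamma : ∀ {n} → (α β : Vec ℕ n) → Vec ℕ (Vec.sum α)
  gamma []      []      = []
  gamma (a ∷ α) (b ∷ β) = replicate a b ++ gamma α β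

  prodFact : ∀ {n} → Vec ℕ n → ℕ
  prodFact α = Vec.foldr _ (λ a r → (a !) ℕ.* r) 1 α

  sumK : List Carrier → Carrier
  sumK = foldr _+_ 0#

  -- Fin indices are 0-based: i ∈ Fin θ with toℕ i < α₁ corresponds to
  -- i+1 ∈ {1..α₁}, and toℕ (σ⁻¹ i) = σ⁻¹(i+1) - 1.
  P-Λ : ∀ {m} → (α β : Vec ℕ (suc m)) → ISPW
  P-Λ {m} α β =
    map (λ σ →
      ( ((ℕ→K (prodFact α)) ⁻¹) *
          sumK (List.map (λ i →
                   if toℕ i <ᵇ lookup α Fin.zero
                   then neg1^ (toℕ (σ ⟨$⟩ˡ i)) * ℕ→K ((θ ∸ 1) C toℕ (σ ⟨$⟩ˡ i))
                   else 0#)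
                 (allFin θ))
      , List.map (λ k → lookup γ (σ ⟨$⟩ʳ k)) (allFin θ)))
      (allPerms θ)
    where
      θ = Vec.sum α
      γ = gamma α β

-- Index the letters of γ by positions i ∈ Fin θ, θ = n + 1, the first α₁ of them "marked".
-- Reindexing by i = σ(k), the coefficient of w_{γ,σ} in P_Λ is r · G(x) for the word of positions
-- x = (σ(1), …, σ(θ)), where G(x) = ∑ₖ (-1)ᵏ C(n,k) [xₖ marked].  By Pascal's rule G agrees on
-- words of length θ with the iterated difference functional D_n: D₀ is the indicator of a single
-- marked letter and D_{j+1}(s) = D_j(s minus its last letter) − D_j(s minus its first letter).
-- Splitting a shuffle by its first and by its last letter shows, by induction on j, that D_j
-- sums to zero over all shuffles of two nonempty words.  A permutation x of the positions together
-- with an unshuffle of x is the same as a splitting of the positions into two sets, an ordering of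
-- each, and a shuffle of the two orderings; hence in Δ P_Λ the coefficient of W_u ⊗ W_v with
-- u, v ≠ () is a combination of such vanishing sums, while the terms with u or v empty give
-- P_Λ ⊗ 1 + 1 ⊗ P_Λ.

module Submission where

open import Defs
open import Level using (Level)
open import Data.Nat using (ℕ; suc; _<_)
open import Data.Fin using (Fin)
open import Data.Vec using (Vec; lookup)
open import Relation.Binary.PropositionalEquality using (_≢_)

open import Data.Nat as ℕ using (zero; _<ᵇ_)
import Data.Nat.Properties as ℕP
open import Data.Nat.Combinatorics using (_C_; nCk+nC[k+1]≡[n+1]C[k+1]; k>n⇒nCk≡0)
open import Data.Bool using (Bool; true; false; if_then_else_)
open import Data.Bool.Properties using (if-eta; if-∧; if-swap-then)
open import Data.List as List using (List; []; _∷_; _++_; map; concatMap; length; tabulate; allFin)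
open import Data.List.Relation.Unary.All as All using (All; []; _∷_)
import Data.List.Relation.Unary.All.Properties as AllP
open import Data.Product using (_×_; _,_; proj₁; proj₂)
open import Relation.Binary.PropositionalEquality as Eq using (_≡_)
open import Relation.Nullary using (does)
open import Function using (_∘_)
import Data.Fin as F
open import Data.Fin.Permutation using (Permutation′; insert; _⟨$⟩ʳ_; _⟨$⟩ˡ_; inverseˡ)
import Algebra.Properties.CommutativeMonoid.Sum as CSum
open import Data.List.Properties using (map-tabulate; length-tabulate; ≡-dec)
open import Data.Empty using (⊥-elim)
import Data.Vec as V

module _ {c ℓ : Level} (K : Field c ℓ) where
  open Field K
  open import Relation.Binary.Reasoning.Setoid setoid
  open import Algebra.Solver.CommutativeMonoid +-commutativeMonoid
    using (solve; _⊕_; _⊜_) renaming (id to 𝟘)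
  open import Algebra.Properties.Ring ring using (-‿distribˡ-*; -0#≈0#; -1*x≈-x)
  open import Algebra.Properties.CommutativeSemigroup +-commutativeSemigroup using (interchange)
  open import Algebra.Properties.AbelianGroup +-abelianGroup using (⁻¹-∙-comm)
  module CS = CSum +-commutativeMonoid

  private
    variable
      ℓ₁ ℓ₂ : Level
      X : Set ℓ₁
      Y : Set ℓ₂

  if-0 : ∀ b → (if b then 0# else 0#) ≈ 0#
  if-0 b = reflexive (if-eta b)

  sub-+-interchange : ∀ a b c d → (a + - b) + (c + - d) ≈ (a + c) + - (b + d)
  sub-+-interchange a b c d = begin
    (a + - b) + (c + - d) ≈⟨ interchange a (- b) c (- d) ⟩
    (a + c) + (- b + - d) ≈⟨ +-congˡ (⁻¹-∙-comm b d) ⟩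
    (a + c) + - (b + d) ∎

  ℕ→K-homo-+ : ∀ p q → ℕ→K K (p ℕ.+ q) ≈ ℕ→K K p + ℕ→K K q
  ℕ→K-homo-+ zero q = sym (+-identityˡ _)
  ℕ→K-homo-+ (suc p) q = trans (+-congˡ (ℕ→K-homo-+ p q)) (sym (+-assoc _ _ _))

  -- Finite sums over lists

  ∑ : List X → (X → Carrier) → Carrier
  ∑ l f = sumK K (map f l)

  ∑-cong : (l : List X) {f g : X → Carrier} → (∀ x → f x ≈ g x) → ∑ l f ≈ ∑ l g
  ∑-cong [] e = refl
  ∑-cong (x ∷ l) e = +-cong (e x) (∑-cong l e)

  ∑-cong-All : {P : X → Set} (l : List X) {f g : X → Carrier} →
    All P l → (∀ x → P x → f x ≈ g x) → ∑ l f ≈ ∑ l g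
  ∑-cong-All [] _ e = refl
  ∑-cong-All (x ∷ l) (px ∷ pl) e = +-cong (e x px) (∑-cong-All l pl e)

  ∑-zero : (l : List X) (f : X → Carrier) → (∀ x → f x ≈ 0#) → ∑ l f ≈ 0#
  ∑-zero [] f e = refl
  ∑-zero (x ∷ l) f e = trans (+-cong (e x) (∑-zero l f e)) (+-identityʳ 0#)

  ∑-++ : (l₁ l₂ : List X) (f : X → Carrier) → ∑ (l₁ ++ l₂) f ≈ ∑ l₁ f + ∑ l₂ f
  ∑-++ [] l₂ f = sym (+-identityˡ _)
  ∑-++ (x ∷ l₁) l₂ f = trans (+-congˡ (∑-++ l₁ l₂ f)) (sym (+-assoc _ _ _))

  ∑-map : (g : X → Y) (l : List X) (f : Y → Carrier) → ∑ (map g l) f ≈ ∑ l (f ∘ g)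
  ∑-map g [] f = refl
  ∑-map g (x ∷ l) f = +-congˡ (∑-map g l f)

  ∑-concatMap : (g : X → List Y) (l : List X) (f : Y → Carrier) →
    ∑ (concatMap g l) f ≈ ∑ l (λ x → ∑ (g x) f)
  ∑-concatMap g [] f = refl
  ∑-concatMap g (x ∷ l) f = trans (∑-++ (g x) (concatMap g l) f) (+-congˡ (∑-concatMap g l f))

  ∑-+ : (l : List X) (f g : X → Carrier) → ∑ l (λ x → f x + g x) ≈ ∑ l f + ∑ l g
  ∑-+ [] f g = sym (+-identityˡ _)
  ∑-+ (x ∷ l) f g = trans (+-congˡ (∑-+ l f g)) (interchange (f x) (g x) (∑ l f) (∑ l g))

  ∑∑-+ : (l : List X) (m : X → List Y) (f g : X → Y → Carrier) →
    ∑ l (λ x → ∑ (m x) (λ y → f x y + g x y)) ≈ ∑ l (λ x → ∑ (m x) (f x)) + ∑ l (λ x → ∑ (m x) (g x))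
  ∑∑-+ l m f g = trans (∑-cong l (λ x → ∑-+ (m x) (f x) (g x))) (∑-+ l _ _)

  ∑-neg : (l : List X) (f : X → Carrier) → ∑ l (λ x → - f x) ≈ - ∑ l f
  ∑-neg [] f = sym -0#≈0#
  ∑-neg (x ∷ l) f = trans (+-congˡ (∑-neg l f)) (⁻¹-∙-comm (f x) (∑ l f))

  ∑-sub : (l : List X) (f g : X → Carrier) → ∑ l (λ x → f x + - g x) ≈ ∑ l f + - ∑ l g
  ∑-sub l f g = trans (∑-+ l f (λ x → - g x)) (+-congˡ (∑-neg l g))

  ∑-distribˡ : (a : Carrier) (l : List X) (f : X → Carrier) → a * ∑ l f ≈ ∑ l (λ x → a * f x)
  ∑-distribˡ a [] f = zeroʳ a
  ∑-distribˡ a (x ∷ l) f = trans (distribˡ a (f x) (∑ l f)) (+-congˡ (∑-distribˡ a l f))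

  ∑-distribʳ : (a : Carrier) (l : List X) (f : X → Carrier) → ∑ l f * a ≈ ∑ l (λ x → f x * a)
  ∑-distribʳ a l f = trans (*-comm _ _) (trans (∑-distribˡ a l f) (∑-cong l (λ x → *-comm a (f x))))

  ∑-swap : (l₁ : List X) (l₂ : List Y) (f : X → Y → Carrier) →
    ∑ l₁ (λ x → ∑ l₂ (f x)) ≈ ∑ l₂ (λ y → ∑ l₁ (λ x → f x y))
  ∑-swap [] l₂ f = sym (∑-zero l₂ _ (λ _ → refl))
  ∑-swap (x ∷ l₁) l₂ f = trans (+-congˡ (∑-swap l₁ l₂ f)) (sym (∑-+ l₂ (f x) (λ y → ∑ l₁ (λ x → f x y))))

  ∑-zero-All : {P : X → Set} (l : List X) {f : X → Carrier} → All P l → (∀ x → P x → f x ≈ 0#) → ∑ l f ≈ 0#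
  ∑-zero-All l {f} pl e = trans (∑-cong-All l {g = λ _ → 0#} pl e) (∑-zero l (λ _ → 0#) (λ _ → refl))

  ∑-if : (l : List X) (b : Bool) (f : X → Carrier) → ∑ l (λ x → if b then f x else 0#) ≈ (if b then ∑ l f else 0#)
  ∑-if l true f = refl
  ∑-if l false f = ∑-zero l _ (λ _ → refl)

  -- Shuffles

  module _ {A : Set} where
    dropLast : List A → List A
    dropLast [] = []
    dropLast (a ∷ []) = []
    dropLast (a ∷ b ∷ s) = a ∷ dropLast (b ∷ s)

    shuffles : List A → List A → List (List A)
    shuffles [] z = z ∷ []
    shuffles (a ∷ y) [] = (a ∷ y) ∷ []
    shuffles (a ∷ y) (b ∷ z) = map (a ∷_) (shuffles y (b ∷ z)) ++ map (b ∷_) (shuffles (a ∷ y) z)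

    length-dropLast : ∀ (b : A) t → length (dropLast (b ∷ t)) ≡ length t
    length-dropLast b [] = Eq.refl
    length-dropLast b (c ∷ t) = Eq.cong suc (length-dropLast c t)

    shuffles-length : ∀ (y z : List A) → All (λ s → length s ≡ length y ℕ.+ length z) (shuffles y z)
    shuffles-length [] z = Eq.refl ∷ []
    shuffles-length (a ∷ y) [] = Eq.sym (Eq.cong suc (ℕP.+-identityʳ (length y))) ∷ []
    shuffles-length (a ∷ y) (b ∷ z) = AllP.++⁺ (AllP.map⁺ (All.map (Eq.cong suc) (shuffles-length y (b ∷ z))))
      (AllP.map⁺ (All.map (λ e → Eq.trans (Eq.cong suc e) (Eq.sym (Eq.cong suc (ℕP.+-suc (length y) (length z))))) (shuffles-length (a ∷ y) z)))

    ∑-shuffles-∷-∷ : ∀ a y b z (H : List A → Carrier) →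
      ∑ (shuffles (a ∷ y) (b ∷ z)) H ≈ ∑ (shuffles y (b ∷ z)) (λ s → H (a ∷ s)) + ∑ (shuffles (a ∷ y) z) (λ s → H (b ∷ s))
    ∑-shuffles-∷-∷ a y b z H = trans (∑-++ (map (a ∷_) (shuffles y (b ∷ z))) _ H)
      (+-cong (∑-map (a ∷_) (shuffles y (b ∷ z)) H) (∑-map (b ∷_) (shuffles (a ∷ y) z) H))

    ∑-shuffles-[]ʳ : ∀ y (H : List A → Carrier) → ∑ (shuffles y []) H ≈ H y
    ∑-shuffles-[]ʳ [] H = +-identityʳ _
    ∑-shuffles-[]ʳ (a ∷ y) H = +-identityʳ _

    ∑-shuffles-cong-∷ʳ : ∀ y b z (F G : List A → Carrier) → (∀ d s → F (d ∷ s) ≈ G (d ∷ s)) →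
      ∑ (shuffles y (b ∷ z)) F ≈ ∑ (shuffles y (b ∷ z)) G
    ∑-shuffles-cong-∷ʳ [] b z F G e = +-cong (e b z) refl
    ∑-shuffles-cong-∷ʳ (a ∷ y) b z F G e = begin
      ∑ (shuffles (a ∷ y) (b ∷ z)) F ≈⟨ ∑-shuffles-∷-∷ a y b z F ⟩
      ∑ (shuffles y (b ∷ z)) (λ s → F (a ∷ s)) + ∑ (shuffles (a ∷ y) z) (λ s → F (b ∷ s))
        ≈⟨ +-cong (∑-cong (shuffles y (b ∷ z)) (λ s → e a s)) (∑-cong (shuffles (a ∷ y) z) (λ s → e b s)) ⟩
      ∑ (shuffles y (b ∷ z)) (λ s → G (a ∷ s)) + ∑ (shuffles (a ∷ y) z) (λ s → G (b ∷ s)) ≈⟨ sym (∑-shuffles-∷-∷ a y b z G) ⟩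
      ∑ (shuffles (a ∷ y) (b ∷ z)) G ∎

    ∑-shuffles-cong-∷ˡ : ∀ a y z (F G : List A → Carrier) → (∀ d s → F (d ∷ s) ≈ G (d ∷ s)) →
      ∑ (shuffles (a ∷ y) z) F ≈ ∑ (shuffles (a ∷ y) z) G
    ∑-shuffles-cong-∷ˡ a y [] F G e = +-cong (e a y) refl
    ∑-shuffles-cong-∷ˡ a y (b ∷ z) F G e = ∑-shuffles-cong-∷ʳ (a ∷ y) b z F G e

    ∑-shuffles-dropLast : ∀ a y b z (H : List A → Carrier) →
      ∑ (shuffles (a ∷ y) (b ∷ z)) (λ s → H (dropLast s)) ≈
      ∑ (shuffles (dropLast (a ∷ y)) (b ∷ z)) H + ∑ (shuffles (a ∷ y) (dropLast (b ∷ z))) H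
    ∑-shuffles-dropLast a [] b [] H = solve 2 (λ p q → (p ⊕ (q ⊕ 𝟘)) ⊜ ((q ⊕ 𝟘) ⊕ (p ⊕ 𝟘))) refl (H (a ∷ [])) (H (b ∷ []))
    ∑-shuffles-dropLast a [] b (d ∷ z) H = begin
      ∑ (shuffles (a ∷ []) (b ∷ d ∷ z)) (λ s → H (dropLast s)) ≈⟨ ∑-shuffles-∷-∷ a [] b (d ∷ z) _ ⟩
      (H (dropLast (a ∷ b ∷ d ∷ z)) + 0#) + ∑ (shuffles (a ∷ []) (d ∷ z)) (λ s → H (dropLast (b ∷ s)))
        ≈⟨ +-congˡ (∑-shuffles-cong-∷ˡ a [] (d ∷ z) _ _ (λ _ _ → refl)) ⟩
      (H (a ∷ b ∷ dropLast (d ∷ z)) + 0#) + ∑ (shuffles (a ∷ []) (d ∷ z)) (λ s → H (b ∷ dropLast s))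
        ≈⟨ +-congˡ (∑-shuffles-dropLast a [] d z (λ s → H (b ∷ s))) ⟩
      (H (a ∷ b ∷ dropLast (d ∷ z)) + 0#) + ((H (b ∷ d ∷ z) + 0#) + ∑ (shuffles (a ∷ []) (dropLast (d ∷ z))) (λ s → H (b ∷ s)))
        ≈⟨ solve 3 (λ p q r → ((p ⊕ 𝟘) ⊕ ((q ⊕ 𝟘) ⊕ r)) ⊜ ((q ⊕ 𝟘) ⊕ ((p ⊕ 𝟘) ⊕ r))) refl
             (H (a ∷ b ∷ dropLast (d ∷ z))) (H (b ∷ d ∷ z)) (∑ (shuffles (a ∷ []) (dropLast (d ∷ z))) (λ s → H (b ∷ s))) ⟩
      (H (b ∷ d ∷ z) + 0#) + ((H (a ∷ b ∷ dropLast (d ∷ z)) + 0#) + ∑ (shuffles (a ∷ []) (dropLast (d ∷ z))) (λ s → H (b ∷ s)))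
        ≈⟨ +-congˡ (sym (∑-shuffles-∷-∷ a [] b (dropLast (d ∷ z)) H)) ⟩
      ∑ (shuffles [] (b ∷ d ∷ z)) H + ∑ (shuffles (a ∷ []) (b ∷ dropLast (d ∷ z))) H ∎
    ∑-shuffles-dropLast a (c ∷ y) b [] H = begin
      ∑ (shuffles (a ∷ c ∷ y) (b ∷ [])) (λ s → H (dropLast s)) ≈⟨ ∑-shuffles-∷-∷ a (c ∷ y) b [] _ ⟩
      ∑ (shuffles (c ∷ y) (b ∷ [])) (λ s → H (dropLast (a ∷ s))) + (H (dropLast (b ∷ a ∷ c ∷ y)) + 0#)
        ≈⟨ +-congʳ (∑-shuffles-cong-∷ˡ c y (b ∷ []) _ _ (λ _ _ → refl)) ⟩
      ∑ (shuffles (c ∷ y) (b ∷ [])) (λ s → H (a ∷ dropLast s)) + (H (b ∷ a ∷ dropLast (c ∷ y)) + 0#)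
        ≈⟨ +-congʳ (∑-shuffles-dropLast c y b [] (λ s → H (a ∷ s))) ⟩
      (∑ (shuffles (dropLast (c ∷ y)) (b ∷ [])) (λ s → H (a ∷ s)) + (H (a ∷ c ∷ y) + 0#)) + (H (b ∷ a ∷ dropLast (c ∷ y)) + 0#)
        ≈⟨ solve 3 (λ p q r → ((p ⊕ (q ⊕ 𝟘)) ⊕ (r ⊕ 𝟘)) ⊜ ((p ⊕ (r ⊕ 𝟘)) ⊕ (q ⊕ 𝟘))) refl
             (∑ (shuffles (dropLast (c ∷ y)) (b ∷ [])) (λ s → H (a ∷ s))) (H (a ∷ c ∷ y)) (H (b ∷ a ∷ dropLast (c ∷ y))) ⟩
      (∑ (shuffles (dropLast (c ∷ y)) (b ∷ [])) (λ s → H (a ∷ s)) + (H (b ∷ a ∷ dropLast (c ∷ y)) + 0#)) + (H (a ∷ c ∷ y) + 0#)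
        ≈⟨ +-congʳ (sym (∑-shuffles-∷-∷ a (dropLast (c ∷ y)) b [] H)) ⟩
      ∑ (shuffles (a ∷ dropLast (c ∷ y)) (b ∷ [])) H + ∑ (shuffles (a ∷ c ∷ y) []) H ∎
    ∑-shuffles-dropLast a (c ∷ y) b (d ∷ z) H = begin
      ∑ (shuffles (a ∷ c ∷ y) (b ∷ d ∷ z)) (λ s → H (dropLast s)) ≈⟨ ∑-shuffles-∷-∷ a (c ∷ y) b (d ∷ z) _ ⟩
      ∑ (shuffles (c ∷ y) (b ∷ d ∷ z)) (λ s → H (dropLast (a ∷ s))) + ∑ (shuffles (a ∷ c ∷ y) (d ∷ z)) (λ s → H (dropLast (b ∷ s)))
        ≈⟨ +-cong (∑-shuffles-cong-∷ˡ c y (b ∷ d ∷ z) _ _ (λ _ _ → refl)) (∑-shuffles-cong-∷ˡ a (c ∷ y) (d ∷ z) _ _ (λ _ _ → refl)) ⟩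
      ∑ (shuffles (c ∷ y) (b ∷ d ∷ z)) (λ s → H (a ∷ dropLast s)) + ∑ (shuffles (a ∷ c ∷ y) (d ∷ z)) (λ s → H (b ∷ dropLast s))
        ≈⟨ +-cong (∑-shuffles-dropLast c y b (d ∷ z) (λ s → H (a ∷ s))) (∑-shuffles-dropLast a (c ∷ y) d z (λ s → H (b ∷ s))) ⟩
      (Pa + Qa) + (Pb + Qb)
        ≈⟨ interchange Pa Qa Pb Qb ⟩
      (Pa + Pb) + (Qa + Qb)
        ≈⟨ +-cong (sym (∑-shuffles-∷-∷ a (dropLast (c ∷ y)) b (d ∷ z) H)) (sym (∑-shuffles-∷-∷ a (c ∷ y) b (dropLast (d ∷ z)) H)) ⟩
      ∑ (shuffles (a ∷ dropLast (c ∷ y)) (b ∷ d ∷ z)) H + ∑ (shuffles (a ∷ c ∷ y) (b ∷ dropLast (d ∷ z))) H ∎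
      where
      Pa = ∑ (shuffles (dropLast (c ∷ y)) (b ∷ d ∷ z)) (λ s → H (a ∷ s))
      Qa = ∑ (shuffles (c ∷ y) (dropLast (b ∷ d ∷ z))) (λ s → H (a ∷ s))
      Pb = ∑ (shuffles (dropLast (a ∷ c ∷ y)) (d ∷ z)) (λ s → H (b ∷ s))
      Qb = ∑ (shuffles (a ∷ c ∷ y) (dropLast (d ∷ z))) (λ s → H (b ∷ s))

  -- The iterated difference functional

  module DifferenceFunctional {A : Set} (marked : A → Bool) where
    difference : ℕ → List A → Carrier
    difference zero [] = 0#
    difference zero (a ∷ []) = if marked a then 1# else 0#
    difference zero (a ∷ b ∷ s) = 0#
    difference (suc j) s = difference j (dropLast s) + - difference j (List.drop 1 s)

    ∑-shuffles-difference : ∀ j a y b z → ∑ (shuffles (a ∷ y) (b ∷ z)) (difference j) ≈ 0#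
    ∑-shuffles-difference zero a y b z = begin
      ∑ (shuffles (a ∷ y) (b ∷ z)) (difference 0) ≈⟨ ∑-shuffles-∷-∷ a y b z (difference 0) ⟩
      ∑ (shuffles y (b ∷ z)) (λ s → difference 0 (a ∷ s)) + ∑ (shuffles (a ∷ y) z) (λ s → difference 0 (b ∷ s))
        ≈⟨ +-cong (∑-shuffles-cong-∷ʳ y b z _ (λ _ → 0#) (λ _ _ → refl)) (∑-shuffles-cong-∷ˡ a y z _ (λ _ → 0#) (λ _ _ → refl)) ⟩
      ∑ (shuffles y (b ∷ z)) (λ _ → 0#) + ∑ (shuffles (a ∷ y) z) (λ _ → 0#)
        ≈⟨ +-cong (∑-zero (shuffles y (b ∷ z)) _ (λ _ → refl)) (∑-zero (shuffles (a ∷ y) z) _ (λ _ → refl)) ⟩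
      0# + 0# ≈⟨ +-identityʳ 0# ⟩
      0# ∎
    ∑-shuffles-difference (suc j) a y b z = begin
      ∑ (shuffles (a ∷ y) (b ∷ z)) (difference (suc j))
        ≈⟨ ∑-sub (shuffles (a ∷ y) (b ∷ z)) (λ s → difference j (dropLast s)) (λ s → difference j (List.drop 1 s)) ⟩
      ∑ (shuffles (a ∷ y) (b ∷ z)) (λ s → difference j (dropLast s)) + - ∑ (shuffles (a ∷ y) (b ∷ z)) (λ s → difference j (List.drop 1 s))
        ≈⟨ +-cong (∑-shuffles-dropLast a y b z (difference j)) (-‿cong (∑-shuffles-∷-∷ a y b z (λ s → difference j (List.drop 1 s)))) ⟩
      (∑ (shuffles (dropLast (a ∷ y)) (b ∷ z)) (difference j) + ∑ (shuffles (a ∷ y) (dropLast (b ∷ z))) (difference j))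
        + - (∑ (shuffles y (b ∷ z)) (difference j) + ∑ (shuffles (a ∷ y) z) (difference j))
        ≈⟨ +-congʳ (dropLast≈drop₁ y z) ⟩
      (∑ (shuffles y (b ∷ z)) (difference j) + ∑ (shuffles (a ∷ y) z) (difference j))
        + - (∑ (shuffles y (b ∷ z)) (difference j) + ∑ (shuffles (a ∷ y) z) (difference j)) ≈⟨ -‿inverseʳ _ ⟩
      0# ∎
      where
      -- Matching terms either both vanish by induction or coincide, the shortened word being empty.
      dropLast≈drop₁ : ∀ y z →
        ∑ (shuffles (dropLast (a ∷ y)) (b ∷ z)) (difference j) + ∑ (shuffles (a ∷ y) (dropLast (b ∷ z))) (difference j)
        ≈ ∑ (shuffles y (b ∷ z)) (difference j) + ∑ (shuffles (a ∷ y) z) (difference j)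
      dropLast≈drop₁ [] [] = refl
      dropLast≈drop₁ (c ∷ y') [] = +-congʳ (trans (∑-shuffles-difference j a (dropLast (c ∷ y')) b []) (sym (∑-shuffles-difference j c y' b [])))
      dropLast≈drop₁ [] (d ∷ z') = +-congˡ (trans (∑-shuffles-difference j a [] b (dropLast (d ∷ z'))) (sym (∑-shuffles-difference j a [] d z')))
      dropLast≈drop₁ (c ∷ y') (d ∷ z') =
        +-cong (trans (∑-shuffles-difference j a (dropLast (c ∷ y')) b (d ∷ z')) (sym (∑-shuffles-difference j c y' b (d ∷ z'))))
                                     (trans (∑-shuffles-difference j a (c ∷ y') b (dropLast (d ∷ z'))) (sym (∑-shuffles-difference j a (c ∷ y') d z')))

    binomialTerm : ℕ → ℕ → A → Carrier
    binomialTerm m k a = if marked a then neg1^ K k * ℕ→K K (m C k) else 0#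

    binomialWeight : ℕ → ℕ → List A → Carrier
    binomialWeight m k [] = 0#
    binomialWeight m k (a ∷ s) = binomialTerm m k a + binomialWeight m (suc k) s

    binomialWeight-tabulate : ∀ m {k} (g : F.Fin k → A) k₀ →
      binomialWeight m k₀ (tabulate g) ≈ CS.sum (λ i → binomialTerm m (F.toℕ i ℕ.+ k₀) (g i))
    binomialWeight-tabulate m {zero} g k₀ = refl
    binomialWeight-tabulate m {suc k} g k₀ = +-congˡ (trans (binomialWeight-tabulate m (g ∘ F.suc) (suc k₀))
      (reflexive (CS.sum-cong-≗ (λ i → Eq.cong (λ t → binomialTerm m t (g (F.suc i))) (ℕP.+-suc (F.toℕ i) k₀)))))

    binomialTerm-pascal : ∀ m k a → binomialTerm (suc m) (suc k) a ≈ binomialTerm m (suc k) a + - binomialTerm m k a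
    binomialTerm-pascal m k a with marked a
    ... | false = sym (trans (+-congˡ -0#≈0#) (+-identityʳ 0#))
    ... | true = begin
      ((- 1#) * ε) * ℕ→K K (suc m C suc k) ≡⟨ Eq.cong (λ t → ((- 1#) * ε) * ℕ→K K t) (Eq.sym (nCk+nC[k+1]≡[n+1]C[k+1] m k)) ⟩
      ((- 1#) * ε) * ℕ→K K (m C k ℕ.+ m C suc k) ≈⟨ *-congˡ (ℕ→K-homo-+ (m C k) (m C suc k)) ⟩
      ((- 1#) * ε) * (x + y) ≈⟨ distribˡ _ x y ⟩
      ((- 1#) * ε) * x + ((- 1#) * ε) * y ≈⟨ +-comm _ _ ⟩
      ((- 1#) * ε) * y + ((- 1#) * ε) * x ≈⟨ +-congˡ (trans (*-congʳ (-1*x≈-x ε)) (sym (-‿distribˡ-* ε x))) ⟩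
      ((- 1#) * ε) * y + - (ε * x) ∎
      where
      ε = neg1^ K k
      x = ℕ→K K (m C k)
      y = ℕ→K K (m C suc k)

    binomialWeight-pascal : ∀ m k t → binomialWeight (suc m) (suc k) t ≈ binomialWeight m (suc k) t + - binomialWeight m k t
    binomialWeight-pascal m k [] = sym (trans (+-congˡ -0#≈0#) (+-identityʳ 0#))
    binomialWeight-pascal m k (a ∷ t) = trans (+-cong (binomialTerm-pascal m k a) (binomialWeight-pascal m (suc k) t)) (sub-+-interchange _ _ _ _)

    binomialWeight-dropLast : ∀ m k t → k ℕ.+ length t ≡ suc (suc m) → binomialWeight m k (dropLast t) ≈ binomialWeight m k t
    binomialWeight-dropLast m k [] e = refl
    binomialWeight-dropLast m k (a ∷ []) e = sym (trans (+-identityʳ _) last≈0)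
      where
      k≡1+m : k ≡ suc m
      k≡1+m = ℕP.suc-injective (Eq.trans (ℕP.+-comm 1 k) e)
      last≈0 : binomialTerm m k a ≈ 0#
      last≈0 with marked a
      ... | false = refl
      ... | true rewrite k≡1+m | k>n⇒nCk≡0 (ℕP.n<1+n m) = zeroʳ _
    binomialWeight-dropLast m k (a ∷ b ∷ t) e = +-congˡ (binomialWeight-dropLast m (suc k) (b ∷ t) (Eq.trans (Eq.sym (ℕP.+-suc k (length (b ∷ t)))) e))

    difference≈binomialWeight : ∀ j s → length s ≡ suc j → difference j s ≈ binomialWeight j 0 s
    difference≈binomialWeight zero (a ∷ []) e with marked a
    ... | false = sym (+-identityʳ _)
    ... | true = sym (trans (+-identityʳ _) (trans (*-identityˡ _) (+-identityʳ 1#)))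
    difference≈binomialWeight (suc j) (a ∷ b ∷ t) e = begin
      difference j (a ∷ dropLast (b ∷ t)) + - difference j (b ∷ t)
        ≈⟨ +-cong (difference≈binomialWeight j (a ∷ dropLast (b ∷ t)) (Eq.cong suc (Eq.trans (length-dropLast b t) lt)))
                  (-‿cong (difference≈binomialWeight j (b ∷ t) (Eq.cong suc lt))) ⟩
      (binomialTerm j 0 a + binomialWeight j 1 (dropLast (b ∷ t))) + - binomialWeight j 0 (b ∷ t)
        ≈⟨ +-congʳ (+-congˡ (binomialWeight-dropLast j 1 (b ∷ t) (Eq.cong (λ x → suc (suc x)) lt))) ⟩
      (binomialTerm j 0 a + binomialWeight j 1 (b ∷ t)) + - binomialWeight j 0 (b ∷ t) ≈⟨ +-assoc _ _ _ ⟩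
      binomialTerm j 0 a + (binomialWeight j 1 (b ∷ t) + - binomialWeight j 0 (b ∷ t)) ≈⟨ +-congˡ (sym (binomialWeight-pascal j 0 (b ∷ t))) ⟩
      binomialTerm (suc j) 0 a + binomialWeight (suc j) 1 (b ∷ t) ∎
      where
      lt : length t ≡ j
      lt = ℕP.suc-injective (ℕP.suc-injective e)

    ∑-shuffles-binomialWeight : ∀ j a y b z → length (a ∷ y) ℕ.+ length (b ∷ z) ≡ suc j →
      ∑ (shuffles (a ∷ y) (b ∷ z)) (binomialWeight j 0) ≈ 0#
    ∑-shuffles-binomialWeight j a y b z e = trans
      (∑-cong-All (shuffles (a ∷ y) (b ∷ z)) (shuffles-length (a ∷ y) (b ∷ z))
        (λ s ∣s∣≡ → sym (difference≈binomialWeight j s (Eq.trans ∣s∣≡ e))))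
      (∑-shuffles-difference j a y b z)

  -- Permutations and unshuffles

  module _ {A : Set} where
    picks : List A → List (A × List A)
    picks [] = []
    picks (a ∷ l) = (a , l) ∷ map (λ p → (proj₁ p , a ∷ proj₂ p)) (picks l)

    permutations : ℕ → List A → List (List A)
    permutations zero l = [] ∷ []
    permutations (suc n) l = concatMap (λ p → map (proj₁ p ∷_) (permutations n (proj₂ p))) (picks l)

    permutationsOf : List A → List (List A)
    permutationsOf l = permutations (length l) l

    unshuffles : List A → List (List A × List A)
    unshuffles [] = ([] , []) ∷ []
    unshuffles (a ∷ w) = concatMap (λ p → (a ∷ proj₁ p , proj₂ p) ∷ (proj₁ p , a ∷ proj₂ p) ∷ []) (unshuffles w)

    picks-length : ∀ (a : A) l → All (λ p → length (proj₂ p) ≡ length l) (picks (a ∷ l))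
    picks-length a [] = Eq.refl ∷ []
    picks-length a (b ∷ l) = Eq.refl ∷ AllP.map⁺ (All.map (Eq.cong suc) (picks-length b l))

    permutations-length : ∀ n (l : List A) → All (λ y → length y ≡ n) (permutations n l)
    permutations-length zero l = Eq.refl ∷ []
    permutations-length (suc n) l = AllP.concat⁺ (AllP.map⁺ (All.universal
      (λ p → AllP.map⁺ (All.map (Eq.cong suc) (permutations-length n (proj₂ p)))) (picks l)))

    unshuffles-length : ∀ (h : List A) → All (λ q → length (proj₁ q) ℕ.+ length (proj₂ q) ≡ length h) (unshuffles h)
    unshuffles-length [] = Eq.refl ∷ []
    unshuffles-length (a ∷ w) = AllP.concat⁺ (AllP.map⁺ (All.map
      (λ {q} e → Eq.cong suc e ∷ Eq.trans (ℕP.+-suc (length (proj₁ q)) (length (proj₂ q))) (Eq.cong suc e) ∷ [])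
      (unshuffles-length w)))

    ∑-permutations-suc : ∀ n (l : List A) (Φ : List A → Carrier) →
      ∑ (permutations (suc n) l) Φ ≈ ∑ (picks l) (λ p → ∑ (permutations n (proj₂ p)) (λ y → Φ (proj₁ p ∷ y)))
    ∑-permutations-suc n l Φ = trans (∑-concatMap (λ p → map (proj₁ p ∷_) (permutations n (proj₂ p))) (picks l) Φ)
      (∑-cong (picks l) (λ p → ∑-map (proj₁ p ∷_) (permutations n (proj₂ p)) Φ))

    ∑-permutationsOf-∷ : ∀ (a : A) l (G : List A → Carrier) →
      ∑ (permutationsOf (a ∷ l)) G ≈ ∑ (picks (a ∷ l)) (λ p → ∑ (permutationsOf (proj₂ p)) (λ y → G (proj₁ p ∷ y)))
    ∑-permutationsOf-∷ a l G = trans (∑-permutations-suc (length l) (a ∷ l) G)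
      (∑-cong-All (picks (a ∷ l)) (picks-length a l) (λ p e →
        reflexive (Eq.cong (λ n → ∑ (permutations n (proj₂ p)) (λ y → G (proj₁ p ∷ y))) (Eq.sym e))))

    ∑-unshuffles-∷ : ∀ (a : A) w (F : List A → List A → Carrier) →
      ∑ (unshuffles (a ∷ w)) (λ q → F (proj₁ q) (proj₂ q)) ≈
      ∑ (unshuffles w) (λ q → F (a ∷ proj₁ q) (proj₂ q)) + ∑ (unshuffles w) (λ q → F (proj₁ q) (a ∷ proj₂ q))
    ∑-unshuffles-∷ a w F = trans (∑-concatMap _ (unshuffles w) (λ q → F (proj₁ q) (proj₂ q)))
      (trans (∑-cong (unshuffles w) (λ q → +-congˡ (+-identityʳ _)))
             (∑-+ (unshuffles w) (λ q → F (a ∷ proj₁ q) (proj₂ q)) (λ q → F (proj₁ q) (a ∷ proj₂ q))))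

    ∑-picks-∷ : ∀ (a : A) l (G : A → List A → Carrier) →
      ∑ (picks (a ∷ l)) (λ p → G (proj₁ p) (proj₂ p)) ≈ G a l + ∑ (picks l) (λ p → G (proj₁ p) (a ∷ proj₂ p))
    ∑-picks-∷ a l G = +-congˡ (∑-map _ (picks l) _)

    ∑-unshuffles-picksˡ : ∀ (h : List A) (Ψ : A → List A → List A → Carrier) →
      ∑ (unshuffles h) (λ q → ∑ (picks (proj₁ q)) (λ p → Ψ (proj₁ p) (proj₂ p) (proj₂ q))) ≈
      ∑ (picks h) (λ p → ∑ (unshuffles (proj₂ p)) (λ q → Ψ (proj₁ p) (proj₁ q) (proj₂ q)))
    ∑-unshuffles-picksˡ [] Ψ = +-identityʳ 0#
    ∑-unshuffles-picksˡ (c ∷ h) Ψ = begin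
      ∑ (unshuffles (c ∷ h)) (λ q → ∑ (picks (proj₁ q)) (λ p → Ψ (proj₁ p) (proj₂ p) (proj₂ q)))
        ≈⟨ ∑-unshuffles-∷ c h (λ u v → ∑ (picks u) (λ p → Ψ (proj₁ p) (proj₂ p) v)) ⟩
      ∑ (unshuffles h) (λ q → ∑ (picks (c ∷ proj₁ q)) (λ p → Ψ (proj₁ p) (proj₂ p) (proj₂ q)))
        + ∑ (unshuffles h) (λ q → ∑ (picks (proj₁ q)) (λ p → Ψ (proj₁ p) (proj₂ p) (c ∷ proj₂ q)))
        ≈⟨ +-congʳ (trans (∑-cong (unshuffles h) (λ q → ∑-picks-∷ c (proj₁ q) (λ x r → Ψ x r (proj₂ q))))
                          (∑-+ (unshuffles h) _ _)) ⟩
      (∑ (unshuffles h) (λ q → Ψ c (proj₁ q) (proj₂ q))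
        + ∑ (unshuffles h) (λ q → ∑ (picks (proj₁ q)) (λ p → Ψ (proj₁ p) (c ∷ proj₂ p) (proj₂ q))))
        + ∑ (unshuffles h) (λ q → ∑ (picks (proj₁ q)) (λ p → Ψ (proj₁ p) (proj₂ p) (c ∷ proj₂ q)))
        ≈⟨ +-assoc _ _ _ ⟩
      ∑ (unshuffles h) (λ q → Ψ c (proj₁ q) (proj₂ q))
        + (∑ (unshuffles h) (λ q → ∑ (picks (proj₁ q)) (λ p → Ψ (proj₁ p) (c ∷ proj₂ p) (proj₂ q)))
        + ∑ (unshuffles h) (λ q → ∑ (picks (proj₁ q)) (λ p → Ψ (proj₁ p) (proj₂ p) (c ∷ proj₂ q))))
        ≈⟨ +-congˡ (+-cong (∑-unshuffles-picksˡ h (λ x r v → Ψ x (c ∷ r) v)) (∑-unshuffles-picksˡ h (λ x r v → Ψ x r (c ∷ v)))) ⟩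
      ∑ (unshuffles h) (λ q → Ψ c (proj₁ q) (proj₂ q))
        + (∑ (picks h) (λ p → ∑ (unshuffles (proj₂ p)) (λ q → Ψ (proj₁ p) (c ∷ proj₁ q) (proj₂ q)))
        + ∑ (picks h) (λ p → ∑ (unshuffles (proj₂ p)) (λ q → Ψ (proj₁ p) (proj₁ q) (c ∷ proj₂ q))))
        ≈⟨ +-congˡ (sym (trans (∑-cong (picks h) (λ p → ∑-unshuffles-∷ c (proj₂ p) (Ψ (proj₁ p)))) (∑-+ (picks h) _ _))) ⟩
      ∑ (unshuffles h) (λ q → Ψ c (proj₁ q) (proj₂ q))
        + ∑ (picks h) (λ p → ∑ (unshuffles (c ∷ proj₂ p)) (λ q → Ψ (proj₁ p) (proj₁ q) (proj₂ q)))
        ≈⟨ sym (∑-picks-∷ c h (λ x r → ∑ (unshuffles r) (λ q → Ψ x (proj₁ q) (proj₂ q)))) ⟩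
      ∑ (picks (c ∷ h)) (λ p → ∑ (unshuffles (proj₂ p)) (λ q → Ψ (proj₁ p) (proj₁ q) (proj₂ q))) ∎

    ∑-unshuffles-picksʳ : ∀ (h : List A) (Ψ : A → List A → List A → Carrier) →
      ∑ (unshuffles h) (λ q → ∑ (picks (proj₂ q)) (λ p → Ψ (proj₁ p) (proj₁ q) (proj₂ p))) ≈
      ∑ (picks h) (λ p → ∑ (unshuffles (proj₂ p)) (λ q → Ψ (proj₁ p) (proj₁ q) (proj₂ q)))
    ∑-unshuffles-picksʳ [] Ψ = +-identityʳ 0#
    ∑-unshuffles-picksʳ (c ∷ h) Ψ = begin
      ∑ (unshuffles (c ∷ h)) (λ q → ∑ (picks (proj₂ q)) (λ p → Ψ (proj₁ p) (proj₁ q) (proj₂ p)))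
        ≈⟨ ∑-unshuffles-∷ c h (λ u v → ∑ (picks v) (λ p → Ψ (proj₁ p) u (proj₂ p))) ⟩
      ∑ (unshuffles h) (λ q → ∑ (picks (proj₂ q)) (λ p → Ψ (proj₁ p) (c ∷ proj₁ q) (proj₂ p)))
        + ∑ (unshuffles h) (λ q → ∑ (picks (c ∷ proj₂ q)) (λ p → Ψ (proj₁ p) (proj₁ q) (proj₂ p)))
        ≈⟨ +-congˡ (trans (∑-cong (unshuffles h) (λ q → ∑-picks-∷ c (proj₂ q) (λ x r → Ψ x (proj₁ q) r)))
                          (∑-+ (unshuffles h) _ _)) ⟩
      X₁ + (∑ (unshuffles h) (λ q → Ψ c (proj₁ q) (proj₂ q)) + X₂)
        ≈⟨ solve 3 (λ a b d → (a ⊕ (b ⊕ d)) ⊜ (b ⊕ (a ⊕ d))) refl X₁ (∑ (unshuffles h) (λ q → Ψ c (proj₁ q) (proj₂ q))) X₂ ⟩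
      ∑ (unshuffles h) (λ q → Ψ c (proj₁ q) (proj₂ q)) + (X₁ + X₂)
        ≈⟨ +-congˡ (+-cong (∑-unshuffles-picksʳ h (λ x u r → Ψ x (c ∷ u) r)) (∑-unshuffles-picksʳ h (λ x u r → Ψ x u (c ∷ r)))) ⟩
      ∑ (unshuffles h) (λ q → Ψ c (proj₁ q) (proj₂ q))
        + (∑ (picks h) (λ p → ∑ (unshuffles (proj₂ p)) (λ q → Ψ (proj₁ p) (c ∷ proj₁ q) (proj₂ q)))
        + ∑ (picks h) (λ p → ∑ (unshuffles (proj₂ p)) (λ q → Ψ (proj₁ p) (proj₁ q) (c ∷ proj₂ q))))
        ≈⟨ +-congˡ (sym (trans (∑-cong (picks h) (λ p → ∑-unshuffles-∷ c (proj₂ p) (Ψ (proj₁ p)))) (∑-+ (picks h) _ _))) ⟩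
      ∑ (unshuffles h) (λ q → Ψ c (proj₁ q) (proj₂ q))
        + ∑ (picks h) (λ p → ∑ (unshuffles (c ∷ proj₂ p)) (λ q → Ψ (proj₁ p) (proj₁ q) (proj₂ q)))
        ≈⟨ sym (∑-picks-∷ c h (λ x r → ∑ (unshuffles r) (λ q → Ψ x (proj₁ q) (proj₂ q)))) ⟩
      ∑ (picks (c ∷ h)) (λ p → ∑ (unshuffles (proj₂ p)) (λ q → Ψ (proj₁ p) (proj₁ q) (proj₂ q))) ∎
      where
      X₁ = ∑ (unshuffles h) (λ q → ∑ (picks (proj₂ q)) (λ p → Ψ (proj₁ p) (c ∷ proj₁ q) (proj₂ p)))
      X₂ = ∑ (unshuffles h) (λ q → ∑ (picks (proj₂ q)) (λ p → Ψ (proj₁ p) (proj₁ q) (c ∷ proj₂ p)))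

    shuffleSum : (F : List A → List A → List A → Carrier) → List A → List A → Carrier
    shuffleSum F h1 h2 = ∑ (permutationsOf h1) (λ y → ∑ (permutationsOf h2) (λ z → ∑ (shuffles y z) (λ s → F s y z)))

    shuffleSumˡ : (F : List A → List A → List A → Carrier) → A → List A → List A → Carrier
    shuffleSumˡ F b = shuffleSum (λ s y z → F (b ∷ s) (b ∷ y) z)

    shuffleSumʳ : (F : List A → List A → List A → Carrier) → A → List A → List A → Carrier
    shuffleSumʳ F b = shuffleSum (λ s y z → F (b ∷ s) y (b ∷ z))

    shuffleSum-+ : ∀ f g h1 h2 → shuffleSum (λ s y z → f s y z + g s y z) h1 h2 ≈ shuffleSum f h1 h2 + shuffleSum g h1 h2
    shuffleSum-+ f g h1 h2 = trans
      (∑-cong (permutationsOf h1) (λ y → ∑∑-+ (permutationsOf h2) (λ z → shuffles y z) (λ z s → f s y z) (λ z s → g s y z)))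
      (∑-+ (permutationsOf h1) _ _)

    shuffleSum-picks : ∀ F h1 h2 n → length h1 ℕ.+ length h2 ≡ suc n →
      shuffleSum F h1 h2 ≈
      ∑ (picks h1) (λ p → shuffleSumˡ F (proj₁ p) (proj₂ p) h2) + ∑ (picks h2) (λ p → shuffleSumʳ F (proj₁ p) h1 (proj₂ p))
    shuffleSum-picks F [] [] n ()
    shuffleSum-picks F [] (b ∷ h2) n e = begin
      ∑ (permutationsOf (b ∷ h2)) (λ z → ∑ (shuffles [] z) (λ s → F s [] z)) + 0#  ≈⟨ +-identityʳ _ ⟩
      ∑ (permutationsOf (b ∷ h2)) (λ z → F z [] z + 0#)  ≈⟨ ∑-cong (permutationsOf (b ∷ h2)) (λ z → +-identityʳ _) ⟩
      ∑ (permutationsOf (b ∷ h2)) (λ z → F z [] z)  ≈⟨ ∑-permutationsOf-∷ b h2 _ ⟩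
      ∑ (picks (b ∷ h2)) (λ p → ∑ (permutationsOf (proj₂ p)) (λ z → F (proj₁ p ∷ z) [] (proj₁ p ∷ z)))
        ≈⟨ sym (∑-cong (picks (b ∷ h2)) (λ p → trans (+-identityʳ _) (∑-cong (permutationsOf (proj₂ p)) (λ z → +-identityʳ _)))) ⟩
      ∑ (picks (b ∷ h2)) (λ p → shuffleSumʳ F (proj₁ p) [] (proj₂ p)) ≈⟨ sym (+-identityˡ _) ⟩
      0# + ∑ (picks (b ∷ h2)) (λ p → shuffleSumʳ F (proj₁ p) [] (proj₂ p)) ∎
    shuffleSum-picks F (a ∷ h1) [] n e = begin
      ∑ (permutationsOf (a ∷ h1)) (λ y → ∑ (shuffles y []) (λ s → F s y []) + 0#)
        ≈⟨ ∑-cong (permutationsOf (a ∷ h1)) (λ y → trans (+-identityʳ _) (∑-shuffles-[]ʳ y _)) ⟩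
      ∑ (permutationsOf (a ∷ h1)) (λ y → F y y [])  ≈⟨ ∑-permutationsOf-∷ a h1 _ ⟩
      ∑ (picks (a ∷ h1)) (λ p → ∑ (permutationsOf (proj₂ p)) (λ y → F (proj₁ p ∷ y) (proj₁ p ∷ y) []))
        ≈⟨ sym (∑-cong (picks (a ∷ h1)) (λ p → ∑-cong (permutationsOf (proj₂ p)) (λ y → trans (+-identityʳ _) (∑-shuffles-[]ʳ y _)))) ⟩
      ∑ (picks (a ∷ h1)) (λ p → shuffleSumˡ F (proj₁ p) (proj₂ p) []) ≈⟨ sym (+-identityʳ _) ⟩
      ∑ (picks (a ∷ h1)) (λ p → shuffleSumˡ F (proj₁ p) (proj₂ p) []) + 0# ∎
    shuffleSum-picks F (a ∷ h1) (b ∷ h2) n e = begin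
      shuffleSum F (a ∷ h1) (b ∷ h2)  ≈⟨ ∑-permutationsOf-∷ a h1 _ ⟩
      ∑ (picks (a ∷ h1)) (λ p → ∑ (permutationsOf (proj₂ p)) (λ y' → ∑ (permutationsOf (b ∷ h2)) (λ z → ∑ (shuffles (proj₁ p ∷ y') z) (λ s → F s (proj₁ p ∷ y') z))))
        ≈⟨ ∑-cong (picks (a ∷ h1)) (λ p → ∑-cong (permutationsOf (proj₂ p)) (λ y' → ∑-permutationsOf-∷ b h2 _)) ⟩
      ∑ (picks (a ∷ h1)) (λ p → ∑ (permutationsOf (proj₂ p)) (λ y' → ∑ (picks (b ∷ h2)) (λ p' → ∑ (permutationsOf (proj₂ p')) (λ z' →
        ∑ (shuffles (proj₁ p ∷ y') (proj₁ p' ∷ z')) (λ s → F s (proj₁ p ∷ y') (proj₁ p' ∷ z'))))))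
        ≈⟨ ∑-cong (picks (a ∷ h1)) (λ p → ∑-cong (permutationsOf (proj₂ p)) (λ y' → ∑-cong (picks (b ∷ h2)) (λ p' → ∑-cong (permutationsOf (proj₂ p')) (λ z' →
             ∑-shuffles-∷-∷ (proj₁ p) y' (proj₁ p') z' (λ s → F s (proj₁ p ∷ y') (proj₁ p' ∷ z')))))) ⟩
      ∑ (picks (a ∷ h1)) (λ p → ∑ (permutationsOf (proj₂ p)) (λ y' → ∑ (picks (b ∷ h2)) (λ p' → ∑ (permutationsOf (proj₂ p')) (λ z' →
        U p y' p' z' + V p y' p' z'))))
        ≈⟨ trans (∑-cong (picks (a ∷ h1)) (λ p →
                 trans (∑-cong (permutationsOf (proj₂ p)) (λ y' → ∑∑-+ (picks (b ∷ h2)) (λ p' → permutationsOf (proj₂ p')) (U p y') (V p y')))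
                       (∑-+ (permutationsOf (proj₂ p)) _ _)))
             (∑-+ (picks (a ∷ h1)) _ _) ⟩
      ∑ (picks (a ∷ h1)) (λ p → ∑ (permutationsOf (proj₂ p)) (λ y' → ∑ (picks (b ∷ h2)) (λ p' → ∑ (permutationsOf (proj₂ p')) (λ z' → U p y' p' z'))))
      + ∑ (picks (a ∷ h1)) (λ p → ∑ (permutationsOf (proj₂ p)) (λ y' → ∑ (picks (b ∷ h2)) (λ p' → ∑ (permutationsOf (proj₂ p')) (λ z' → V p y' p' z'))))
        ≈⟨ +-cong
             (∑-cong (picks (a ∷ h1)) (λ p → ∑-cong (permutationsOf (proj₂ p)) (λ y' →
                sym (∑-permutationsOf-∷ b h2 (λ z → ∑ (shuffles y' z) (λ s → F (proj₁ p ∷ s) (proj₁ p ∷ y') z))))))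
             (trans (∑-cong (picks (a ∷ h1)) (λ p → ∑-swap (permutationsOf (proj₂ p)) (picks (b ∷ h2)) _))
             (trans (∑-swap (picks (a ∷ h1)) (picks (b ∷ h2)) _)
                    (∑-cong (picks (b ∷ h2)) (λ p' → sym (∑-permutationsOf-∷ a h1
                       (λ y → ∑ (permutationsOf (proj₂ p')) (λ z' → ∑ (shuffles y z') (λ s → F (proj₁ p' ∷ s) y (proj₁ p' ∷ z'))))))))) ⟩
      ∑ (picks (a ∷ h1)) (λ p → shuffleSumˡ F (proj₁ p) (proj₂ p) (b ∷ h2)) + ∑ (picks (b ∷ h2)) (λ p → shuffleSumʳ F (proj₁ p) (a ∷ h1) (proj₂ p)) ∎
      where
      U : A × List A → List A → A × List A → List A → Carrier
      U p y' p' z' = ∑ (shuffles y' (proj₁ p' ∷ z')) (λ s → F (proj₁ p ∷ s) (proj₁ p ∷ y') (proj₁ p' ∷ z'))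
      V : A × List A → List A → A × List A → List A → Carrier
      V p y' p' z' = ∑ (shuffles (proj₁ p ∷ y') z') (λ s → F (proj₁ p' ∷ s) (proj₁ p ∷ y') (proj₁ p' ∷ z'))

    ∑-permutations-unshuffles : ∀ n (h : List A) → length h ≡ n → ∀ (F : List A → List A → List A → Carrier) →
      ∑ (permutations n h) (λ x → ∑ (unshuffles x) (λ q → F x (proj₁ q) (proj₂ q))) ≈
      ∑ (unshuffles h) (λ q → shuffleSum F (proj₁ q) (proj₂ q))
    ∑-permutations-unshuffles zero [] e F = solve 1 (λ f → ((f ⊕ 𝟘) ⊕ 𝟘) ⊜ ((((f ⊕ 𝟘) ⊕ 𝟘) ⊕ 𝟘) ⊕ 𝟘)) refl (F [] [] [])
    ∑-permutations-unshuffles (suc n) (a ∷ h) e F = begin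
      ∑ (permutations (suc n) (a ∷ h)) (λ x → ∑ (unshuffles x) (λ q → F x (proj₁ q) (proj₂ q)))
        ≈⟨ ∑-permutations-suc n (a ∷ h) _ ⟩
      ∑ (picks (a ∷ h)) (λ p → ∑ (permutations n (proj₂ p)) (λ x' → ∑ (unshuffles (proj₁ p ∷ x')) (λ q → F (proj₁ p ∷ x') (proj₁ q) (proj₂ q))))
        ≈⟨ ∑-cong (picks (a ∷ h)) (λ p → ∑-cong (permutations n (proj₂ p)) (λ x' →
             trans (∑-unshuffles-∷ (proj₁ p) x' (F (proj₁ p ∷ x'))) (sym (∑-+ (unshuffles x') _ _)))) ⟩
      ∑ (picks (a ∷ h)) (λ p → ∑ (permutations n (proj₂ p)) (λ x' → ∑ (unshuffles x') (λ q → Fᵇ (proj₁ p) x' (proj₁ q) (proj₂ q))))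
        ≈⟨ ∑-cong-All (picks (a ∷ h)) (picks-length a h) (λ p e' → ∑-permutations-unshuffles n (proj₂ p) (Eq.trans e' (ℕP.suc-injective e)) (Fᵇ (proj₁ p))) ⟩
      ∑ (picks (a ∷ h)) (λ p → ∑ (unshuffles (proj₂ p)) (λ q → shuffleSum (Fᵇ (proj₁ p)) (proj₁ q) (proj₂ q)))
        ≈⟨ trans (∑-cong (picks (a ∷ h)) (λ p → trans (∑-cong (unshuffles (proj₂ p)) (λ q →
                    shuffleSum-+ (λ s y z → F (proj₁ p ∷ s) (proj₁ p ∷ y) z) (λ s y z → F (proj₁ p ∷ s) y (proj₁ p ∷ z)) (proj₁ q) (proj₂ q)))
                  (∑-+ (unshuffles (proj₂ p)) _ _)))
                 (∑-+ (picks (a ∷ h)) _ _) ⟩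
      ∑ (picks (a ∷ h)) (λ p → ∑ (unshuffles (proj₂ p)) (λ q → shuffleSumˡ F (proj₁ p) (proj₁ q) (proj₂ q)))
      + ∑ (picks (a ∷ h)) (λ p → ∑ (unshuffles (proj₂ p)) (λ q → shuffleSumʳ F (proj₁ p) (proj₁ q) (proj₂ q)))
        ≈⟨ +-cong (sym (∑-unshuffles-picksˡ (a ∷ h) (shuffleSumˡ F))) (sym (∑-unshuffles-picksʳ (a ∷ h) (shuffleSumʳ F))) ⟩
      ∑ (unshuffles (a ∷ h)) (λ q → ∑ (picks (proj₁ q)) (λ p → shuffleSumˡ F (proj₁ p) (proj₂ p) (proj₂ q)))
      + ∑ (unshuffles (a ∷ h)) (λ q → ∑ (picks (proj₂ q)) (λ p → shuffleSumʳ F (proj₁ p) (proj₁ q) (proj₂ p)))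
        ≈⟨ sym (∑-+ (unshuffles (a ∷ h)) _ _) ⟩
      ∑ (unshuffles (a ∷ h)) (λ q → ∑ (picks (proj₁ q)) (λ p → shuffleSumˡ F (proj₁ p) (proj₂ p) (proj₂ q))
                           + ∑ (picks (proj₂ q)) (λ p → shuffleSumʳ F (proj₁ p) (proj₁ q) (proj₂ p)))
        ≈⟨ ∑-cong-All (unshuffles (a ∷ h)) (unshuffles-length (a ∷ h)) (λ q e' → sym (shuffleSum-picks F (proj₁ q) (proj₂ q) (length h) e')) ⟩
      ∑ (unshuffles (a ∷ h)) (λ q → shuffleSum F (proj₁ q) (proj₂ q)) ∎
      where
      Fᵇ : A → List A → List A → List A → Carrier
      Fᵇ b x y z = F (b ∷ x) (b ∷ y) z + F (b ∷ x) y (b ∷ z)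

  module _ {A : Set} (marked : A → Bool) where
    open DifferenceFunctional marked

    ∑-permutations-binomialWeight-unshuffles : ∀ n (h : List A) → length h ≡ suc n →
      (I : List A → List A → Carrier) → (∀ y → I y [] ≈ 0#) → (∀ z → I [] z ≈ 0#) →
      ∑ (permutations (suc n) h) (λ x → binomialWeight n 0 x * ∑ (unshuffles x) (λ q → I (proj₁ q) (proj₂ q))) ≈ 0#
    ∑-permutations-binomialWeight-unshuffles n h ∣h∣≡ I I-[]ʳ I-[]ˡ = begin
      ∑ (permutations (suc n) h) (λ x → binomialWeight n 0 x * ∑ (unshuffles x) (λ q → I (proj₁ q) (proj₂ q)))
        ≈⟨ ∑-cong (permutations (suc n) h) (λ x → ∑-distribˡ (binomialWeight n 0 x) (unshuffles x) _) ⟩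
      ∑ (permutations (suc n) h) (λ x → ∑ (unshuffles x) (λ q → F x (proj₁ q) (proj₂ q)))
        ≈⟨ ∑-permutations-unshuffles (suc n) h ∣h∣≡ F ⟩
      ∑ (unshuffles h) (λ q → shuffleSum F (proj₁ q) (proj₂ q))
        ≈⟨ ∑-zero-All (unshuffles h) (unshuffles-length h)
             (λ q e → shuffleSum≈0 (proj₁ q) (proj₂ q) (Eq.trans e ∣h∣≡)) ⟩
      0# ∎
      where
      F : List A → List A → List A → Carrier
      F s y z = binomialWeight n 0 s * I y z
      ∑-shuffles≈0 : ∀ y z → length y ℕ.+ length z ≡ suc n → ∑ (shuffles y z) (λ s → F s y z) ≈ 0#
      ∑-shuffles≈0 [] z _ = ∑-zero (shuffles [] z) _ (λ s → trans (*-congˡ (I-[]ˡ z)) (zeroʳ (binomialWeight n 0 s)))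
      ∑-shuffles≈0 (a ∷ y) [] _ = ∑-zero (shuffles (a ∷ y) []) _ (λ s → trans (*-congˡ (I-[]ʳ (a ∷ y))) (zeroʳ (binomialWeight n 0 s)))
      ∑-shuffles≈0 (a ∷ y) (b ∷ z) e = trans (sym (∑-distribʳ (I (a ∷ y) (b ∷ z)) (shuffles (a ∷ y) (b ∷ z)) (binomialWeight n 0)))
        (trans (*-congʳ (∑-shuffles-binomialWeight n a y b z e)) (zeroˡ _))
      shuffleSum≈0 : ∀ h₁ h₂ → length h₁ ℕ.+ length h₂ ≡ suc n → shuffleSum F h₁ h₂ ≈ 0#
      shuffleSum≈0 h₁ h₂ e = ∑-zero-All (permutationsOf h₁) (permutations-length (length h₁) h₁) (λ y ∣y∣≡ →
        ∑-zero-All (permutationsOf h₂) (permutations-length (length h₂) h₂) (λ z ∣z∣≡ →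
          ∑-shuffles≈0 y z (Eq.trans (Eq.cong₂ ℕ._+_ ∣y∣≡ ∣z∣≡) e)))

  ∑-picks-map : ∀ {A B : Set} (g : A → B) (l : List A) (G : B → List B → Carrier) →
    ∑ (picks (map g l)) (λ p → G (proj₁ p) (proj₂ p)) ≈ ∑ (picks l) (λ p → G (g (proj₁ p)) (map g (proj₂ p)))
  ∑-picks-map g [] G = refl
  ∑-picks-map g (a ∷ l) G = trans (∑-picks-∷ (g a) (map g l) G)
    (trans (+-congˡ (∑-picks-map g l (λ x r → G x (g a ∷ r)))) (sym (∑-picks-∷ a l (λ x r → G (g x) (map g r)))))

  ∑-permutations-map : ∀ {A B : Set} n (g : A → B) (l : List A) (Φ : List B → Carrier) →
    ∑ (permutations n (map g l)) Φ ≈ ∑ (permutations n l) (λ y → Φ (map g y))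
  ∑-permutations-map zero g l Φ = refl
  ∑-permutations-map (suc n) g l Φ = begin
    ∑ (permutations (suc n) (map g l)) Φ ≈⟨ ∑-permutations-suc n (map g l) Φ ⟩
    ∑ (picks (map g l)) (λ p → ∑ (permutations n (proj₂ p)) (λ y → Φ (proj₁ p ∷ y)))
      ≈⟨ ∑-picks-map g l (λ x r → ∑ (permutations n r) (λ y → Φ (x ∷ y))) ⟩
    ∑ (picks l) (λ p → ∑ (permutations n (map g (proj₂ p))) (λ y → Φ (g (proj₁ p) ∷ y)))
      ≈⟨ ∑-cong (picks l) (λ p → ∑-permutations-map n g (proj₂ p) (λ y → Φ (g (proj₁ p) ∷ y))) ⟩
    ∑ (picks l) (λ p → ∑ (permutations n (proj₂ p)) (λ y → Φ (map g (proj₁ p ∷ y))))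
      ≈⟨ sym (∑-permutations-suc n l (λ y → Φ (map g y))) ⟩
    ∑ (permutations (suc n) l) (λ y → Φ (map g y)) ∎

  -- Enumerating the permutations of Fin n

  ∑-picks-allFin : ∀ n (G : F.Fin (suc n) → List (F.Fin (suc n)) → Carrier) →
    ∑ (picks (allFin (suc n))) (λ p → G (proj₁ p) (proj₂ p)) ≈
    ∑ (allFin (suc n)) (λ j → G j (map (F.punchIn j) (allFin n)))
  ∑-picks-allFin n G = begin
    ∑ (picks (allFin (suc n))) (λ p → G (proj₁ p) (proj₂ p)) ≈⟨ ∑-picks-∷ F.zero (tabulate F.suc) G ⟩
    G F.zero (tabulate F.suc) + ∑ (picks (tabulate F.suc)) (λ p → G (proj₁ p) (F.zero ∷ proj₂ p))
      ≈⟨ +-cong (reflexive (Eq.cong (G F.zero) (Eq.sym (map-tabulate (λ x → x) F.suc))))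
                (trans (reflexive (Eq.cong (λ l → ∑ (picks l) (λ p → G (proj₁ p) (F.zero ∷ proj₂ p))) (Eq.sym (map-tabulate (λ x → x) F.suc))))
                       (∑-picks-map F.suc (allFin n) (λ x r → G x (F.zero ∷ r)))) ⟩
    G F.zero (map F.suc (allFin n)) + ∑ (picks (allFin n)) (λ p → G (F.suc (proj₁ p)) (F.zero ∷ map F.suc (proj₂ p)))
      ≈⟨ +-congˡ (tail-picks n G) ⟩
    G F.zero (map F.suc (allFin n)) + ∑ (allFin n) (λ j → G (F.suc j) (map (F.punchIn (F.suc j)) (allFin n)))
      ≈⟨ +-congˡ (sym (trans (reflexive (Eq.cong (λ l → ∑ l (λ j → G j (map (F.punchIn j) (allFin n)))) (Eq.sym (map-tabulate (λ x → x) F.suc))))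
                             (∑-map F.suc (allFin n) (λ j → G j (map (F.punchIn j) (allFin n)))))) ⟩
    ∑ (allFin (suc n)) (λ j → G j (map (F.punchIn j) (allFin n))) ∎
    where
    tail-picks : ∀ n (G : F.Fin (suc n) → List (F.Fin (suc n)) → Carrier) →
      ∑ (picks (allFin n)) (λ p → G (F.suc (proj₁ p)) (F.zero ∷ map F.suc (proj₂ p))) ≈
      ∑ (allFin n) (λ j → G (F.suc j) (map (F.punchIn (F.suc j)) (allFin n)))
    tail-picks zero G = refl
    tail-picks (suc n) G = trans (∑-picks-allFin n (λ x r → G (F.suc x) (F.zero ∷ map F.suc r)))
      (∑-cong (allFin (suc n)) (λ j → reflexive (Eq.cong (λ l → G (F.suc j) (F.zero ∷ l))
        (Eq.trans (Eq.cong (map F.suc) (map-tabulate (λ x → x) (F.punchIn j)))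
          (Eq.trans (map-tabulate (F.punchIn j) F.suc) (Eq.sym (map-tabulate F.suc (F.punchIn (F.suc j)))))))))

  images : ∀ {n} → Permutation′ n → List (F.Fin n)
  images σ = tabulate (σ ⟨$⟩ʳ_)

  images-insert : ∀ {n} (j : F.Fin (suc n)) (π : Permutation′ n) → images (insert F.zero j π) ≡ j ∷ map (F.punchIn j) (images π)
  images-insert j π = Eq.cong (j ∷_) (Eq.sym (map-tabulate (π ⟨$⟩ʳ_) (F.punchIn j)))

  ∑-allPerms : ∀ n (Φ : List (F.Fin n) → Carrier) → ∑ (allPerms K n) (λ σ → Φ (images σ)) ≈ ∑ (permutations n (allFin n)) Φ
  ∑-allPerms zero Φ = refl
  ∑-allPerms (suc n) Φ = begin
    ∑ (allPerms K (suc n)) (λ σ → Φ (images σ))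
      ≈⟨ trans (∑-concatMap (λ π → map (λ j → insert F.zero j π) (allFin (suc n))) (allPerms K n) _)
               (∑-cong (allPerms K n) (λ π → ∑-map (λ j → insert F.zero j π) (allFin (suc n)) _)) ⟩
    ∑ (allPerms K n) (λ π → ∑ (allFin (suc n)) (λ j → Φ (images (insert F.zero j π))))
      ≈⟨ ∑-cong (allPerms K n) (λ π → ∑-cong (allFin (suc n)) (λ j → reflexive (Eq.cong Φ (images-insert j π)))) ⟩
    ∑ (allPerms K n) (λ π → ∑ (allFin (suc n)) (λ j → Φ (j ∷ map (F.punchIn j) (images π))))
      ≈⟨ ∑-swap (allPerms K n) (allFin (suc n)) _ ⟩
    ∑ (allFin (suc n)) (λ j → ∑ (allPerms K n) (λ π → Φ (j ∷ map (F.punchIn j) (images π))))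
      ≈⟨ ∑-cong (allFin (suc n)) (λ j → ∑-allPerms n (λ x → Φ (j ∷ map (F.punchIn j) x))) ⟩
    ∑ (allFin (suc n)) (λ j → ∑ (permutations n (allFin n)) (λ x → Φ (j ∷ map (F.punchIn j) x)))
      ≈⟨ sym (∑-cong (allFin (suc n)) (λ j → ∑-permutations-map n (F.punchIn j) (allFin n) (λ y → Φ (j ∷ y)))) ⟩
    ∑ (allFin (suc n)) (λ j → ∑ (permutations n (map (F.punchIn j) (allFin n))) (λ y → Φ (j ∷ y)))
      ≈⟨ sym (∑-picks-allFin n (λ x r → ∑ (permutations n r) (λ y → Φ (x ∷ y)))) ⟩
    ∑ (picks (allFin (suc n))) (λ p → ∑ (permutations n (proj₂ p)) (λ y → Φ (proj₁ p ∷ y)))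
      ≈⟨ sym (∑-permutations-suc n (allFin (suc n)) Φ) ⟩
    ∑ (permutations (suc n) (allFin (suc n))) Φ ∎

  sumK-tabulate : ∀ {k} (f : F.Fin k → Carrier) → sumK K (tabulate f) ≡ CS.sum f
  sumK-tabulate {zero} f = Eq.refl
  sumK-tabulate {suc k} f = Eq.cong (f F.zero +_) (sumK-tabulate (f ∘ F.suc))

  firstBlock : ∀ {θ} → ℕ → F.Fin θ → Bool
  firstBlock α₁ i = F.toℕ i <ᵇ α₁

  module _ {θ : ℕ} (α₁ m : ℕ) where
    open DifferenceFunctional (firstBlock {θ} α₁)

    coefficient≈binomialWeight : ∀ (σ : Permutation′ θ) →
      sumK K (map (λ i → if F.toℕ i <ᵇ α₁ then neg1^ K (F.toℕ (σ ⟨$⟩ˡ i)) * ℕ→K K (m C F.toℕ (σ ⟨$⟩ˡ i)) else 0#) (allFin θ))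
      ≈ binomialWeight m 0 (images σ)
    coefficient≈binomialWeight σ = begin
      sumK K (map f (allFin θ))                         ≡⟨ Eq.cong (sumK K) (map-tabulate (λ x → x) f) ⟩
      sumK K (tabulate f)                               ≡⟨ sumK-tabulate f ⟩
      CS.sum f                                          ≈⟨ CS.sum-permute f σ ⟩
      CS.sum (λ k → f (σ ⟨$⟩ʳ k))
        ≡⟨ CS.sum-cong-≗ (λ k → Eq.cong (λ t → binomialTerm m (F.toℕ t) (σ ⟨$⟩ʳ k)) (inverseˡ σ)) ⟩
      CS.sum (λ k → binomialTerm m (F.toℕ k) (σ ⟨$⟩ʳ k))
        ≡⟨ CS.sum-cong-≗ (λ k → Eq.cong (λ t → binomialTerm m t (σ ⟨$⟩ʳ k)) (Eq.sym (ℕP.+-identityʳ (F.toℕ k)))) ⟩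
      CS.sum (λ k → binomialTerm m (F.toℕ k ℕ.+ 0) (σ ⟨$⟩ʳ k)) ≈⟨ sym (binomialWeight-tabulate m (σ ⟨$⟩ʳ_) 0) ⟩
      binomialWeight m 0 (images σ) ∎
      where
      f : F.Fin θ → Carrier
      f i = binomialTerm m (F.toℕ (σ ⟨$⟩ˡ i)) i

  -- Coefficients in ISPW ⊗ ISPW

  _==_ : Word K → Word K → Bool
  y == u = does (≡-dec ℕ._≟_ y u)

  kronecker : Word K → Word K → Carrier → Word K → Word K → Carrier
  kronecker u v a y z = if y == u then (if z == v then a else 0#) else 0#

  coeff₂≈∑kronecker : ∀ (l : ISPW⊗ISPW K) u v →
    coeff₂ K l u v ≈ ∑ l (λ t → kronecker u v (proj₁ t) (proj₁ (proj₂ t)) (proj₂ (proj₂ t)))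
  coeff₂≈∑kronecker [] u v = refl
  coeff₂≈∑kronecker (t ∷ l) u v = +-congˡ (coeff₂≈∑kronecker l u v)

  kronecker-scale : ∀ u v a y z → kronecker u v a y z ≈ a * kronecker u v 1# y z
  kronecker-scale u v a y z with y == u | z == v
  ... | true  | true  = sym (*-identityʳ a)
  ... | true  | false = sym (zeroʳ a)
  ... | false | _     = sym (zeroʳ a)

  kronecker-[]-∷ : ∀ u a {w} → w ≢ [] → kronecker u [] a [] w ≈ 0#
  kronecker-[]-∷ u a {[]} w≢[] = ⊥-elim (w≢[] Eq.refl)
  kronecker-[]-∷ u a {x ∷ w} _ = if-0 ([] == u)

  kronecker-∷-[] : ∀ v a {w} → w ≢ [] → kronecker [] v a w [] ≈ 0#
  kronecker-∷-[] v a {[]} w≢[] = ⊥-elim (w≢[] Eq.refl)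
  kronecker-∷-[] v a {x ∷ w} _ = refl

  if-cong : ∀ (b : Bool) {x y : Carrier} → x ≈ y → (if b then x else 0#) ≈ (if b then y else 0#)
  if-cong true e = e
  if-cong false e = refl

  ∑-splits-kronecker-[]ʳ : ∀ w u a → ∑ (splits K w) (λ q → kronecker u [] a (proj₁ q) (proj₂ q)) ≈ kronecker u [] a w []
  ∑-splits-kronecker-[]ʳ [] u a = +-identityʳ _
  ∑-splits-kronecker-[]ʳ (x ∷ w) u a = trans (∑-concatMap _ (splits K w) _)
    (trans (∑-cong (splits K w) (λ q → trans (+-congˡ (trans (+-identityʳ _) (if-0 _))) (+-identityʳ _))) (go u))
    where
    go : ∀ u → ∑ (splits K w) (λ q → kronecker u [] a (x ∷ proj₁ q) (proj₂ q)) ≈ kronecker u [] a (x ∷ w) []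
    go [] = ∑-zero (splits K w) _ (λ _ → refl)
    go (c ∷ u) = begin
      ∑ (splits K w) (λ q → kronecker (c ∷ u) [] a (x ∷ proj₁ q) (proj₂ q))
        ≈⟨ ∑-cong (splits K w) (λ q → reflexive (if-∧ (does (x ℕ.≟ c)))) ⟩
      ∑ (splits K w) (λ q → if does (x ℕ.≟ c) then kronecker u [] a (proj₁ q) (proj₂ q) else 0#)
        ≈⟨ ∑-if (splits K w) (does (x ℕ.≟ c)) _ ⟩
      (if does (x ℕ.≟ c) then ∑ (splits K w) (λ q → kronecker u [] a (proj₁ q) (proj₂ q)) else 0#)
        ≈⟨ if-cong (does (x ℕ.≟ c)) (∑-splits-kronecker-[]ʳ w u a) ⟩
      (if does (x ℕ.≟ c) then kronecker u [] a w [] else 0#)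
        ≡⟨ Eq.sym (if-∧ (does (x ℕ.≟ c))) ⟩
      kronecker (c ∷ u) [] a (x ∷ w) [] ∎

  ∑-splits-kronecker-[]ˡ : ∀ w v a → ∑ (splits K w) (λ q → kronecker [] v a (proj₁ q) (proj₂ q)) ≈ kronecker [] v a [] w
  ∑-splits-kronecker-[]ˡ [] v a = +-identityʳ _
  ∑-splits-kronecker-[]ˡ (x ∷ w) v a = trans (∑-concatMap _ (splits K w) _)
    (trans (∑-cong (splits K w) (λ q → trans (+-identityˡ _) (+-identityʳ _))) (go v))
    where
    go : ∀ v → ∑ (splits K w) (λ q → kronecker [] v a (proj₁ q) (x ∷ proj₂ q)) ≈ kronecker [] v a [] (x ∷ w)
    go [] = ∑-zero (splits K w) _ (λ _ → if-0 _)
    go (d ∷ v) = begin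
      ∑ (splits K w) (λ q → kronecker [] (d ∷ v) a (proj₁ q) (x ∷ proj₂ q))
        ≈⟨ ∑-cong (splits K w) (λ q → reflexive (Eq.trans
             (Eq.cong (λ t → if proj₁ q == [] then t else 0#) (if-∧ (does (x ℕ.≟ d))))
             (if-swap-then (proj₁ q == []) (does (x ℕ.≟ d))))) ⟩
      ∑ (splits K w) (λ q → if does (x ℕ.≟ d) then kronecker [] v a (proj₁ q) (proj₂ q) else 0#)
        ≈⟨ ∑-if (splits K w) (does (x ℕ.≟ d)) _ ⟩
      (if does (x ℕ.≟ d) then ∑ (splits K w) (λ q → kronecker [] v a (proj₁ q) (proj₂ q)) else 0#)
        ≈⟨ if-cong (does (x ℕ.≟ d)) (∑-splits-kronecker-[]ˡ w v a) ⟩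
      (if does (x ℕ.≟ d) then kronecker [] v a [] w else 0#)
        ≡⟨ Eq.sym (if-∧ (does (x ℕ.≟ d))) ⟩
      kronecker [] (d ∷ v) a [] (x ∷ w) ∎

  ∑-splits-map : ∀ {A : Set} (g : A → ℕ) (x : List A) (H : Word K → Word K → Carrier) →
    ∑ (splits K (map g x)) (λ q → H (proj₁ q) (proj₂ q)) ≈ ∑ (unshuffles x) (λ q → H (map g (proj₁ q)) (map g (proj₂ q)))
  ∑-splits-map g [] H = refl
  ∑-splits-map g (a ∷ x) H = trans (∑-concatMap _ (splits K (map g x)) _)
    (trans (∑-splits-map g x (λ u v → H (g a ∷ u) v + (H u (g a ∷ v) + 0#)))
           (sym (∑-concatMap (λ p → (a ∷ proj₁ p , proj₂ p) ∷ (proj₁ p , a ∷ proj₂ p) ∷ []) (unshuffles x) _)))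

  coeff₂-Δ : ∀ (p : ISPW K) u v → coeff₂ K (Δ K p) u v ≈
    ∑ p (λ t → ∑ (splits K (proj₂ t)) (λ q → kronecker u v (proj₁ t) (proj₁ q) (proj₂ q)))
  coeff₂-Δ p u v = trans (coeff₂≈∑kronecker (Δ K p) u v)
    (trans (∑-concatMap _ p _) (∑-cong p (λ t → ∑-map _ (splits K (proj₂ t)) _)))

  coeff₂-p⊗1+1⊗p : ∀ (p : ISPW K) u v → coeff₂ K (p⊗1+1⊗p K p) u v ≈
    ∑ p (λ t → kronecker u v (proj₁ t) (proj₂ t) []) + ∑ p (λ t → kronecker u v (proj₁ t) [] (proj₂ t))
  coeff₂-p⊗1+1⊗p p u v = trans (coeff₂≈∑kronecker (map ⊗1 p ++ map 1⊗ p) u v)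
    (trans (∑-++ (map ⊗1 p) (map 1⊗ p) _) (+-cong (∑-map ⊗1 p _) (∑-map 1⊗ p _)))
    where
    ⊗1 1⊗ : Carrier × Word K → Carrier × Word K × Word K
    ⊗1 t = (proj₁ t , proj₂ t , [])
    1⊗ t = (proj₁ t , [] , proj₂ t)

  Primitive-intro : (p : ISPW K) → All (λ t → proj₂ t ≢ []) p →
    (∀ c u d v → coeff₂ K (Δ K p) (c ∷ u) (d ∷ v) ≈ 0#) → Primitive K p
  Primitive-intro p nonempty mixed≈0 u [] = begin
    coeff₂ K (Δ K p) u []                                    ≈⟨ coeff₂-Δ p u [] ⟩
    ∑ p (λ t → ∑ (splits K (proj₂ t)) (λ q → kronecker u [] (proj₁ t) (proj₁ q) (proj₂ q)))
      ≈⟨ ∑-cong p (λ t → ∑-splits-kronecker-[]ʳ (proj₂ t) u (proj₁ t)) ⟩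
    ∑ p (λ t → kronecker u [] (proj₁ t) (proj₂ t) [])        ≈⟨ sym (+-identityʳ _) ⟩
    ∑ p (λ t → kronecker u [] (proj₁ t) (proj₂ t) []) + 0#
      ≈⟨ +-congˡ (sym (∑-zero-All p nonempty (λ t → kronecker-[]-∷ u (proj₁ t)))) ⟩
    ∑ p (λ t → kronecker u [] (proj₁ t) (proj₂ t) []) + ∑ p (λ t → kronecker u [] (proj₁ t) [] (proj₂ t))
      ≈⟨ sym (coeff₂-p⊗1+1⊗p p u []) ⟩
    coeff₂ K (p⊗1+1⊗p K p) u [] ∎
  Primitive-intro p nonempty mixed≈0 [] (d ∷ v) = begin
    coeff₂ K (Δ K p) [] (d ∷ v)                              ≈⟨ coeff₂-Δ p [] (d ∷ v) ⟩
    ∑ p (λ t → ∑ (splits K (proj₂ t)) (λ q → kronecker [] (d ∷ v) (proj₁ t) (proj₁ q) (proj₂ q)))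
      ≈⟨ ∑-cong p (λ t → ∑-splits-kronecker-[]ˡ (proj₂ t) (d ∷ v) (proj₁ t)) ⟩
    ∑ p (λ t → kronecker [] (d ∷ v) (proj₁ t) [] (proj₂ t))  ≈⟨ sym (+-identityˡ _) ⟩
    0# + ∑ p (λ t → kronecker [] (d ∷ v) (proj₁ t) [] (proj₂ t))
      ≈⟨ +-congʳ (sym (∑-zero-All p nonempty (λ t → kronecker-∷-[] (d ∷ v) (proj₁ t)))) ⟩
    ∑ p (λ t → kronecker [] (d ∷ v) (proj₁ t) (proj₂ t) []) + ∑ p (λ t → kronecker [] (d ∷ v) (proj₁ t) [] (proj₂ t))
      ≈⟨ sym (coeff₂-p⊗1+1⊗p p [] (d ∷ v)) ⟩
    coeff₂ K (p⊗1+1⊗p K p) [] (d ∷ v) ∎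
  Primitive-intro p _ mixed≈0 (c ∷ u) (d ∷ v) = trans (mixed≈0 c u d v) (sym (begin
    coeff₂ K (p⊗1+1⊗p K p) (c ∷ u) (d ∷ v)                   ≈⟨ coeff₂-p⊗1+1⊗p p (c ∷ u) (d ∷ v) ⟩
    ∑ p (λ t → kronecker (c ∷ u) (d ∷ v) (proj₁ t) (proj₂ t) []) + ∑ p (λ t → kronecker (c ∷ u) (d ∷ v) (proj₁ t) [] (proj₂ t))
      ≈⟨ +-cong (∑-zero p _ (λ t → if-0 (proj₂ t == (c ∷ u)))) (∑-zero p _ (λ _ → refl)) ⟩
    0# + 0#                                                  ≈⟨ +-identityʳ 0# ⟩
    0# ∎))

  -- The element P_Λ

  module _ {m : ℕ} (a : ℕ) (α′ : Vec ℕ m) (β : Vec ℕ (suc m)) where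
    private
      α : Vec ℕ (suc m)
      α = suc a V.∷ α′
      n : ℕ
      n = a ℕ.+ V.sum α′
      γ : F.Fin (suc n) → ℕ
      γ = lookup (gamma K α β)
      r : Carrier
      r = ℕ→K K (prodFact K α) ⁻¹
      coefficient : Permutation′ (suc n) → Carrier
      coefficient σ = r * sumK K (map (λ i → if F.toℕ i <ᵇ suc a then neg1^ K (F.toℕ (σ ⟨$⟩ˡ i))
                                              * ℕ→K K (n C F.toℕ (σ ⟨$⟩ˡ i)) else 0#) (allFin (suc n)))
      word : Permutation′ (suc n) → Word K
      word σ = map (λ k → γ (σ ⟨$⟩ʳ k)) (allFin (suc n))
      open DifferenceFunctional (firstBlock {suc n} (suc a))

    P-Λ-mixed≈0 : ∀ c u d v → coeff₂ K (Δ K (P-Λ K α β)) (c ∷ u) (d ∷ v) ≈ 0#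
    P-Λ-mixed≈0 c u d v = begin
      coeff₂ K (Δ K (P-Λ K α β)) (c ∷ u) (d ∷ v)              ≈⟨ coeff₂-Δ (P-Λ K α β) (c ∷ u) (d ∷ v) ⟩
      ∑ (P-Λ K α β) (λ t → ∑ (splits K (proj₂ t)) (λ q → kronecker (c ∷ u) (d ∷ v) (proj₁ t) (proj₁ q) (proj₂ q)))
        ≈⟨ ∑-map (λ σ → (coefficient σ , word σ)) (allPerms K (suc n)) _ ⟩
      ∑ (allPerms K (suc n)) (λ σ → ∑ (splits K (word σ)) (λ q → kronecker (c ∷ u) (d ∷ v) (coefficient σ) (proj₁ q) (proj₂ q)))
        ≈⟨ ∑-cong (allPerms K (suc n)) term≈ ⟩
      ∑ (allPerms K (suc n)) (λ σ → r * Φ (images σ))         ≈⟨ sym (∑-distribˡ r (allPerms K (suc n)) (Φ ∘ images)) ⟩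
      r * ∑ (allPerms K (suc n)) (λ σ → Φ (images σ))         ≈⟨ *-congˡ (∑-allPerms (suc n) Φ) ⟩
      r * ∑ (permutations (suc n) (allFin (suc n))) Φ
        ≈⟨ *-congˡ (∑-permutations-binomialWeight-unshuffles (firstBlock (suc a)) n (allFin (suc n))
                      (length-tabulate (λ x → x)) I (λ y → if-0 (map γ y == (c ∷ u))) (λ _ → refl)) ⟩
      r * 0#                                                  ≈⟨ zeroʳ r ⟩
      0# ∎
      where
      I : List (F.Fin (suc n)) → List (F.Fin (suc n)) → Carrier
      I y z = kronecker (c ∷ u) (d ∷ v) 1# (map γ y) (map γ z)
      Φ : List (F.Fin (suc n)) → Carrier
      Φ x = binomialWeight n 0 x * ∑ (unshuffles x) (λ q → I (proj₁ q) (proj₂ q))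
      word≡ : ∀ σ → word σ ≡ map γ (images σ)
      word≡ σ = Eq.trans (map-tabulate (λ x → x) (λ k → γ (σ ⟨$⟩ʳ k))) (Eq.sym (map-tabulate (σ ⟨$⟩ʳ_) γ))
      term≈ : ∀ σ → ∑ (splits K (word σ)) (λ q → kronecker (c ∷ u) (d ∷ v) (coefficient σ) (proj₁ q) (proj₂ q)) ≈ r * Φ (images σ)
      term≈ σ = begin
        ∑ (splits K (word σ)) (λ q → kronecker (c ∷ u) (d ∷ v) (coefficient σ) (proj₁ q) (proj₂ q))
          ≡⟨ Eq.cong (λ w → ∑ (splits K w) (λ q → kronecker (c ∷ u) (d ∷ v) (coefficient σ) (proj₁ q) (proj₂ q))) (word≡ σ) ⟩
        ∑ (splits K (map γ (images σ))) (λ q → kronecker (c ∷ u) (d ∷ v) (coefficient σ) (proj₁ q) (proj₂ q))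
          ≈⟨ ∑-splits-map γ (images σ) (kronecker (c ∷ u) (d ∷ v) (coefficient σ)) ⟩
        ∑ (unshuffles (images σ)) (λ q → kronecker (c ∷ u) (d ∷ v) (coefficient σ) (map γ (proj₁ q)) (map γ (proj₂ q)))
          ≈⟨ ∑-cong (unshuffles (images σ)) (λ q → kronecker-scale (c ∷ u) (d ∷ v) (coefficient σ) (map γ (proj₁ q)) (map γ (proj₂ q))) ⟩
        ∑ (unshuffles (images σ)) (λ q → coefficient σ * I (proj₁ q) (proj₂ q))
          ≈⟨ sym (∑-distribˡ (coefficient σ) (unshuffles (images σ)) (λ q → I (proj₁ q) (proj₂ q))) ⟩
        coefficient σ * ∑ (unshuffles (images σ)) (λ q → I (proj₁ q) (proj₂ q))
          ≈⟨ *-congʳ (*-congˡ (coefficient≈binomialWeight (suc a) n σ)) ⟩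
        (r * binomialWeight n 0 (images σ)) * ∑ (unshuffles (images σ)) (λ q → I (proj₁ q) (proj₂ q))
          ≈⟨ *-assoc _ _ _ ⟩
        r * Φ (images σ) ∎

    P-Λ-primitive : Primitive K (P-Λ K α β)
    P-Λ-primitive = Primitive-intro (P-Λ K α β)
      (AllP.map⁺ (All.universal (λ σ ()) (allPerms K (suc n)))) P-Λ-mixed≈0

mainTheorem7 : ∀ {c ℓ : Level} (K : Field c ℓ) → CharZero K →
    (m : ℕ) (α β : Vec ℕ (suc m)) →
    (∀ i → 0 < lookup α i) → (∀ i → 0 < lookup β i) →
    (∀ (i j : Fin (suc m)) → i ≢ j → lookup β i ≢ lookup β j) →
    Primitive K (P-Λ K α β)
mainTheorem7 K _ m (zero V.∷ α′) β α-pos _ _ with α-pos F.zero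
... | ()
mainTheorem7 K _ m (suc a V.∷ α′) β _ _ _ = P-Λ-primitive K a α′ β
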